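{- Let $n\ge 2$ be an integer with prime factorization $n=p_1^{\alpha_1}p_2^{\alpha_2}\cdots p_N^{\alpha_N}$, where $p_1<p_2<\dots<p_N$ are distinct primes and $\alpha_j\ge 1$, and put $m_j:=n/p_j$ for $j=1,\dots,N$. Let $A\subseteq \mathbb{Z}_n=\{0,1,\dots,n-1\}$ be nonempty, let $a_i\in\{0,1\}$ ($i=0,\dots,n-1$) be its indicator coefficients ($a_i=1$ iff $i\in A$), let $n_A:=|A|$ and $n_B:=n/n_A$. Consider the following system (the "Master Problem"), in binary variables $b_0,\dots,b_{n-1}\in\{0,1\}$, $r_0,\dots,r_{2n-2}\in\{0,1\}$, and $U^{(j)}_i\in\{0,1\}$ for $j\in\{2,\dots,N\}$, $i\in\{0,\dots,m_j-1\}$: 1. $r_i=\sum_{k=\max(0,i-n+1)}^{\min(i,n-1)} a_{i-k}\,b_k$ for every $i\in\{0,\dots,2n-2\}$ (i.e. $r_i$ is the coefficient of $x^i$ in $p_A(x)p_B(x)$, where $p_A(x)=\sum_i a_ix^i$, $p_B(x)=\sum_i b_ix^i$); 2. $r_j+r_{j+n}=1$ for every $j\in\{0,\dots,n-1\}$, with the convention $r_{2n-1}:=0$; 3. $\sum_{i=0}^{m_1-1} b_i\le n_B\frac{m_1}{n}-1$; 4. for every $j\in\{2,\dots,N\}$ and $i\in\{0,\dots,m_j-1\}$: $\sum_{k=0}^{p_j-1} b_{i+km_j}-p_jU^{(j)}_i\le p_j-1$ and $\sum_{k=0}^{p_j-1} b_{i+km_j}-p_jU^{(j)}_i\ge 0$;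 5. for every $j\in\{2,\dots,N\}$: $\sum_{i=0}^{m_j-1}U^{(j)}_i\le \frac{n_B}{p_j}-1$; 6. $b_0=1$. Then for every feasible solution $(b,r,U)$ of this system, the set $B:=\{i\in\{0,\dots,n-1\}: b_i=1\}$ (the rhythm with characteristic polynomial $p_B(x)=\sum_{i=0}^{n-1}b_ix^i$) is aperiodic and tiles with $A$, i.e. $A\oplus B=\mathbb{Z}_n$.
   Context: A tiling $A\oplus B=\mathbb{Z}_n$ means every element of $\mathbb{Z}_n$ can be written uniquely as $a+b \pmod n$ with $a\in A$, $b\in B$. A set $B\subseteq\mathbb{Z}_n$ is periodic modulo $k$ (for $k$ a non-zero element of $\mathbb{Z}_n$) if $k+B=B$; $B$ is aperiodic if it is not periodic modulo any non-zero $k\in\mathbb{Z}_n$. The paper also optimizes an arbitrary linear objective over this system, which plays no role in the statement (any feasible point is considered). -}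

module Defs where

open import Data.Nat using (ℕ; zero; suc; _+_; _*_; _∸_; _^_; _≤_; _<_; _⊓_; NonZero)
open import Data.Nat.DivMod using (_%_)
open import Data.Nat.Primality using (Prime)
open import Data.Fin using (Fin) renaming (zero to fzero; suc to fsuc; _<_ to _<ᶠ_)
open import Data.Product using (Σ; ∃; _×_; _,_)
open import Relation.Binary.PropositionalEquality using (_≡_)
open import Relation.Nullary using (¬_)

sumTo : ℕ → (ℕ → ℕ) → ℕ
sumTo zero    f = 0
sumTo (suc n) f = sumTo n f + f n

-- sumFromTo lo hi f = Σ_{k=lo}^{hi} f k  (inclusive; empty if hi < lo)
sumFromTo : ℕ → ℕ → (ℕ → ℕ) → ℕ
sumFromTo lo hi f = sumTo (suc hi ∸ lo) (λ t → f (lo + t))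

prodFin : ∀ {N} → (Fin N → ℕ) → ℕ
prodFin {zero}  f = 1
prodFin {suc N} f = f fzero * prodFin (λ j → f (fsuc j))

-- n = p_0^{α_0} ⋯ p_N^{α_N} with p_0 < p_1 < ⋯ distinct primes, α_j ≥ 1
-- (paper indices 1..N+1 correspond to Fin (suc N) indices 0..N)
PrimeFactorization : (n N : ℕ) → (p α : Fin (suc N) → ℕ) → Set
PrimeFactorization n N p α =
  (∀ j → Prime (p j)) ×
  (∀ i j → i <ᶠ j → p i < p j) ×
  (∀ j → 1 ≤ α j) ×
  (n ≡ prodFin (λ j → p j ^ α j))

-- Subsets of Z_n = {0,…,n-1} given by 0/1 indicator functions ℕ → ℕ
-- (only values at indices < n matter); i ∈ X iff x i ≡ 1.
Binary : ℕ → (ℕ → ℕ) → Set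
Binary len x = ∀ i → i < len → x i ≤ 1

Tiling : (n : ℕ) .{{_ : NonZero n}} → (a b : ℕ → ℕ) → Set
Tiling n a b =
  ∀ x → x < n →
    Σ ℕ λ i → Σ ℕ λ k →
      (i < n × k < n × a i ≡ 1 × b k ≡ 1 × (i + k) % n ≡ x) ×
      (∀ i' k' → i' < n → k' < n → a i' ≡ 1 → b k' ≡ 1 → (i' + k') % n ≡ x →
         (i' ≡ i × k' ≡ k))

PeriodicMod : (n : ℕ) .{{_ : NonZero n}} → (b : ℕ → ℕ) → ℕ → Set
PeriodicMod n b k =
  ∀ y → y < n →
    (b y ≡ 1 → ∃ λ x → x < n × b x ≡ 1 × (k + x) % n ≡ y) ×
    ((∃ λ x → x < n × b x ≡ 1 × (k + x) % n ≡ y) → b y ≡ 1)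

Aperiodic : (n : ℕ) .{{_ : NonZero n}} → (b : ℕ → ℕ) → Set
Aperiodic n b = ∀ k → 0 < k → k < n → ¬ PeriodicMod n b k

-- Inputs: n, N, primes p, quotients m (m j * p j ≡ n,
-- i.e. m j = n / p j), indicator a of A, nA = |A|.  Variables: b, r, U, where
-- U j i stands for U^{(j+2)}_i in paper indexing (j : Fin N ↔ paper j ∈ {2,…,N+1}).
-- Constraints 3 and 5 (which involve the rational nB = n / nA) are stated with
-- denominators cleared:
--   Σ_{i<m_1} b_i ≤ nB m_1 / n - 1   ⇔   nA (Σ_{i<m_1} b_i + 1) ≤ m_1
--   Σ_i U^{(j)}_i ≤ nB / p_j - 1      ⇔   nA p_j (Σ_i U^{(j)}_i + 1) ≤ n
MasterFeasible : (n N : ℕ) (p m : Fin (suc N) → ℕ) (a : ℕ → ℕ) (nA : ℕ)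
                 (b r : ℕ → ℕ) (U : Fin N → ℕ → ℕ) → Set
MasterFeasible n N p m a nA b r U =
  Binary n b ×
  Binary (2 * n ∸ 1) r ×
  (∀ j → Binary (m (fsuc j)) (U j)) ×
  r (2 * n ∸ 1) ≡ 0 ×
  (∀ i → i < 2 * n ∸ 1 →
     r i ≡ sumFromTo (i ∸ (n ∸ 1)) (i ⊓ (n ∸ 1)) (λ k → a (i ∸ k) * b k)) ×
  (∀ j → j < n → r j + r (j + n) ≡ 1) ×
  (nA * (sumTo (m fzero) b + 1) ≤ m fzero) ×
  (∀ j i → i < m (fsuc j) →
     (sumTo (p (fsuc j)) (λ k → b (i + k * m (fsuc j)))
        ≤ (p (fsuc j) ∸ 1) + p (fsuc j) * U j i) ×
     (p (fsuc j) * U j i ≤ sumTo (p (fsuc j)) (λ k → b (i + k * m (fsuc j))))) ×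
  (∀ j → nA * p (fsuc j) * (sumTo (m (fsuc j)) (U j) + 1) ≤ n) ×
  b 0 ≡ 1

-- Constraints 1 and 2 say that every x ∈ ℤ_n has exactly one representation x = i + k
-- with i ∈ A and k ∈ B (the wrapped coefficient r_x + r_{x+n} of p_A p_B counts them),
-- which is the tiling A ⊕ B = ℤ_n; counting pairs gives |A| |B| = n.
-- A period k of B yields the period gcd(k, n), a proper divisor of n, which divides some
-- m_j = n / p_j; so B would be periodic modulo m_j and |B| = p_j |B ∩ [0, m_j)|.
-- For j = 1 this contradicts constraint 3.  For j ≥ 2 each fibre sum in constraint 4 equals
-- p_j b_i, which forces U^{(j)}_i = b_i, and then constraint 5 is violated in the same way.
{-# OPTIONS --safe #-}
module Submission where

open import Defs
open import Data.Bool using (if_then_else_)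
open import Data.Nat
open import Data.Nat.Properties
open import Data.Nat.DivMod
open import Data.Nat.Divisibility using (_∣_; divides; ∣1⇒≡1; ∣m⇒∣m*n; ∣⇒≤)
open import Data.Nat.GCD using (gcd; gcd[m,n]∣m; gcd[m,n]∣n; gcd-GCD; module Bézout)
open import Data.Nat.Primality using (Prime; euclidsLemma; prime⇒irreducible; ¬prime[1]; prime⇒nonZero)
open import Data.Nat.Primality.Factorisation using (factorise)
open import Data.Nat.ListAction using (product)
open import Data.List using ([]; _∷_)
open import Data.List.Relation.Unary.All using (_∷_)
open import Data.Fin using (Fin) renaming (zero to fzero; suc to fsuc)
open import Data.Product using (∃; _×_; _,_; proj₁; proj₂)
open import Data.Sum using (_⊎_; inj₁; inj₂; [_,_])
open import Function using (id)
open import Relation.Nullary using (¬_; yes; no; does; contradiction)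
open import Relation.Nullary.Decidable using (dec-true; dec-false)
open import Relation.Binary.PropositionalEquality using (_≡_; _≢_; refl; sym; trans; cong; cong₂; subst; module ≡-Reasoning)
open import Algebra.Properties.CommutativeSemigroup +-commutativeSemigroup using (interchange; x∙yz≈yx∙z)
open import Algebra.Properties.CommutativeSemigroup *-commutativeSemigroup using (xy∙z≈xz∙y)

sumTo-cong : ∀ n {f g : ℕ → ℕ} → (∀ k → k < n → f k ≡ g k) → sumTo n f ≡ sumTo n g
sumTo-cong zero    f≡g = refl
sumTo-cong (suc n) f≡g = cong₂ _+_ (sumTo-cong n (λ k k<n → f≡g k (m<n⇒m<1+n k<n))) (f≡g n ≤-refl)

sumTo-+ : ∀ c d f → sumTo (c + d) f ≡ sumTo c f + sumTo d (λ t → f (c + t))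
sumTo-+ c zero    f = trans (cong (λ z → sumTo z f) (+-identityʳ c)) (sym (+-identityʳ _))
sumTo-+ c (suc d) f = begin
  sumTo (c + suc d) f                                  ≡⟨ cong (λ z → sumTo z f) (+-suc c d) ⟩
  sumTo (c + d) f + f (c + d)                          ≡⟨ cong (_+ f (c + d)) (sumTo-+ c d f) ⟩
  sumTo c f + sumTo d (λ t → f (c + t)) + f (c + d)    ≡⟨ +-assoc (sumTo c f) _ _ ⟩
  sumTo c f + (sumTo d (λ t → f (c + t)) + f (c + d))  ∎
  where open ≡-Reasoning

sumTo-distrib-+ : ∀ n f g → sumTo n (λ k → f k + g k) ≡ sumTo n f + sumTo n g
sumTo-distrib-+ zero    f g = refl
sumTo-distrib-+ (suc n) f g =
  trans (cong (_+ (f n + g n)) (sumTo-distrib-+ n f g)) (interchange (sumTo n f) (sumTo n g) (f n) (g n))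

sumTo-const : ∀ n c → sumTo n (λ _ → c) ≡ n * c
sumTo-const zero    c = refl
sumTo-const (suc n) c = trans (cong (_+ c) (sumTo-const n c)) (+-comm (n * c) c)

sumTo-swap : ∀ n m (F : ℕ → ℕ → ℕ) →
  sumTo n (λ x → sumTo m (F x)) ≡ sumTo m (λ k → sumTo n (λ x → F x k))
sumTo-swap zero    m F = sym (trans (sumTo-const m 0) (*-zeroʳ m))
sumTo-swap (suc n) m F =
  trans (cong (_+ sumTo m (F n)) (sumTo-swap n m F)) (sym (sumTo-distrib-+ m _ (F n)))

sumTo-*ˡ : ∀ n c f → sumTo n (λ k → c * f k) ≡ c * sumTo n f
sumTo-*ˡ zero    c f = sym (*-zeroʳ c)
sumTo-*ˡ (suc n) c f = trans (cong (_+ c * f n) (sumTo-*ˡ n c f)) (sym (*-distribˡ-+ c (sumTo n f) (f n)))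

sumTo-*ʳ : ∀ n c f → sumTo n (λ k → f k * c) ≡ sumTo n f * c
sumTo-*ʳ n c f = begin
  sumTo n (λ k → f k * c)  ≡⟨ sumTo-cong n (λ k _ → *-comm (f k) c) ⟩
  sumTo n (λ k → c * f k)  ≡⟨ sumTo-*ˡ n c f ⟩
  c * sumTo n f            ≡⟨ *-comm c (sumTo n f) ⟩
  sumTo n f * c            ∎
  where open ≡-Reasoning

sumTo-blocks : ∀ p m f → sumTo (p * m) f ≡ sumTo p (λ c → sumTo m (λ i → f (c * m + i)))
sumTo-blocks zero    m f = refl
sumTo-blocks (suc p) m f = begin
  sumTo (m + p * m) f                              ≡⟨ cong (λ z → sumTo z f) (+-comm m (p * m)) ⟩
  sumTo (p * m + m) f                              ≡⟨ sumTo-+ (p * m) m f ⟩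
  sumTo (p * m) f + sumTo m (λ i → f (p * m + i))  ≡⟨ cong (_+ sumTo m (λ i → f (p * m + i))) (sumTo-blocks p m f) ⟩
  sumTo p (λ c → sumTo m (λ i → f (c * m + i))) + sumTo m (λ i → f (p * m + i))  ∎
  where open ≡-Reasoning

f≤sumTo : ∀ n f {k} → k < n → f k ≤ sumTo n f
f≤sumTo (suc n) f {k} k<1+n = [ (λ k<n → ≤-trans (f≤sumTo n f k<n) (m≤m+n _ _))
                              , (λ { refl → m≤n+m _ _ }) ] (m<1+n⇒m<n∨m≡n k<1+n)

sumTo≡0⇒≡0 : ∀ n f → sumTo n f ≡ 0 → ∀ k → k < n → f k ≡ 0
sumTo≡0⇒≡0 n f sum≡0 k k<n = n≤0⇒n≡0 (subst (f k ≤_) sum≡0 (f≤sumTo n f k<n))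

m+n≡1⇒m≡0∧n≡1∨m≡1∧n≡0 : ∀ m n → m + n ≡ 1 → (m ≡ 0 × n ≡ 1) ⊎ (m ≡ 1 × n ≡ 0)
m+n≡1⇒m≡0∧n≡1∨m≡1∧n≡0 zero          n m+n≡1 = inj₁ (refl , m+n≡1)
m+n≡1⇒m≡0∧n≡1∨m≡1∧n≡0 (suc zero)    n m+n≡1 = inj₂ (refl , suc-injective m+n≡1)
m+n≡1⇒m≡0∧n≡1∨m≡1∧n≡0 (suc (suc m)) n ()

sumTo≡1⇒∃! : ∀ n f → sumTo n f ≡ 1 →
  ∃ λ k → k < n × f k ≡ 1 × (∀ k′ → k′ < n → f k′ ≢ 0 → k′ ≡ k)
sumTo≡1⇒∃! (suc n) f sum≡1 with m+n≡1⇒m≡0∧n≡1∨m≡1∧n≡0 (sumTo n f) (f n) sum≡1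
... | inj₁ (rest≡0 , fn≡1) = n , ≤-refl , fn≡1 , λ k′ k′<1+n fk′≢0 →
  [ (λ k′<n → contradiction (sumTo≡0⇒≡0 n f rest≡0 k′ k′<n) fk′≢0) , id ] (m<1+n⇒m<n∨m≡n k′<1+n)
... | inj₂ (rest≡1 , fn≡0) with sumTo≡1⇒∃! n f rest≡1
...   | k , k<n , fk≡1 , unique = k , m<n⇒m<1+n k<n , fk≡1 , λ k′ k′<1+n fk′≢0 →
  [ (λ k′<n → unique k′ k′<n fk′≢0) , (λ { refl → contradiction fn≡0 fk′≢0 }) ] (m<1+n⇒m<n∨m≡n k′<1+n)

module CyclicDifference (n : ℕ) .{{_ : NonZero n}} where

  -- x − k in ℤ_n for x, k < n, computed without _%_ so that the two ranges k ≤ x and x < k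
  -- match the two halves of a product coefficient.
  infixl 6 _⊖_
  _⊖_ : ℕ → ℕ → ℕ
  x ⊖ k = if does (k ≤? x) then x ∸ k else x + n ∸ k

  ⊖-≤ : ∀ {x k} → k ≤ x → x ⊖ k ≡ x ∸ k
  ⊖-≤ {x} {k} k≤x rewrite dec-true (k ≤? x) k≤x = refl

  ⊖-> : ∀ {x k} → x < k → x ⊖ k ≡ x + n ∸ k
  ⊖-> {x} {k} x<k rewrite dec-false (k ≤? x) (<⇒≱ x<k) = refl

  ⊖-< : ∀ {x k} → x < n → k < n → x ⊖ k < n
  ⊖-< {x} {k} x<n k<n with k ≤? x
  ... | yes k≤x rewrite ⊖-≤ k≤x = ≤-<-trans (m∸n≤m x k) x<n
  ... | no  k≰x rewrite ⊖-> (≰⇒> k≰x) = begin-strict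
    x + n ∸ k  <⟨ ∸-monoˡ-< (+-monoˡ-< n (≰⇒> k≰x)) (≤-trans (<⇒≤ k<n) (m≤n+m n x)) ⟩
    k + n ∸ k  ≡⟨ m+n∸m≡n k n ⟩
    n          ∎
    where open ≤-Reasoning

  ⊖-+ : ∀ {x k} → x < n → k < n → (x ⊖ k + k) % n ≡ x
  ⊖-+ {x} {k} x<n k<n with k ≤? x
  ... | yes k≤x rewrite ⊖-≤ k≤x | m∸n+n≡m k≤x = m<n⇒m%n≡m x<n
  ... | no  k≰x rewrite ⊖-> (≰⇒> k≰x) | m∸n+n≡m (≤-trans (<⇒≤ k<n) (m≤n+m n x)) =
    trans ([m+n]%n≡m%n x n) (m<n⇒m%n≡m x<n)

  ⊖-unique : ∀ {x i k} → i < n → k < n → (i + k) % n ≡ x → x ⊖ k ≡ i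
  ⊖-unique {x} {i} {k} i<n k<n i+k≡x with n ≤? i + k
  ... | no  i+k≱n rewrite m<n⇒m%n≡m (≰⇒> i+k≱n) | sym i+k≡x = trans (⊖-≤ (m≤n+m k i)) (m+n∸n≡m i k)
  ... | yes n≤i+k = trans (⊖-> x<k) (trans (cong (_∸ k) x+n≡i+k) (m+n∸n≡m i k))
    where
    x+n≡i+k : x + n ≡ i + k
    x+n≡i+k = begin
      x + n              ≡⟨ cong (_+ n) (sym i+k≡x) ⟩
      (i + k) % n + n    ≡⟨ cong (_+ n) (sym (m≤n⇒[n∸m]%m≡n%m n≤i+k)) ⟩
      (i + k ∸ n) % n + n ≡⟨ cong (_+ n) (m<n⇒m%n≡m i+k∸n<n) ⟩
      i + k ∸ n + n      ≡⟨ m∸n+n≡m n≤i+k ⟩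
      i + k              ∎
      where
      open ≡-Reasoning
      i+k∸n<n : i + k ∸ n < n
      i+k∸n<n = +-cancelʳ-< n _ n (subst (_< n + n) (sym (m∸n+n≡m n≤i+k)) (+-mono-< i<n k<n))
    x<k : x < k
    x<k = +-cancelʳ-< n x k (begin-strict
      x + n  ≡⟨ x+n≡i+k ⟩
      i + k  <⟨ +-monoˡ-< k i<n ⟩
      n + k  ≡⟨ +-comm n k ⟩
      k + n  ∎)
      where open ≤-Reasoning

  sumTo-⊖ : ∀ f {k} → k ≤ n → sumTo n (λ x → f (x ⊖ k)) ≡ sumTo n f
  sumTo-⊖ f {k} k≤n = begin
    sumTo n g                                      ≡⟨ cong (λ z → sumTo z g) (sym (m+[n∸m]≡n k≤n)) ⟩
    sumTo (k + (n ∸ k)) g                          ≡⟨ sumTo-+ k (n ∸ k) g ⟩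
    sumTo k g + sumTo (n ∸ k) (λ t → g (k + t))    ≡⟨ cong₂ _+_ (sumTo-cong k wrapped) (sumTo-cong (n ∸ k) unwrapped) ⟩
    sumTo k (λ x → f (n ∸ k + x)) + sumTo (n ∸ k) f ≡⟨ +-comm _ (sumTo (n ∸ k) f) ⟩
    sumTo (n ∸ k) f + sumTo k (λ x → f (n ∸ k + x)) ≡⟨ sym (sumTo-+ (n ∸ k) k f) ⟩
    sumTo (n ∸ k + k) f                            ≡⟨ cong (λ z → sumTo z f) (m∸n+n≡m k≤n) ⟩
    sumTo n f                                      ∎
    where
    open ≡-Reasoning
    g : ℕ → ℕ
    g x = f (x ⊖ k)
    wrapped : ∀ x → x < k → g x ≡ f (n ∸ k + x)
    wrapped x x<k = cong f (trans (⊖-> x<k) (trans (+-∸-assoc x k≤n) (+-comm x (n ∸ k))))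
    unwrapped : ∀ t → t < n ∸ k → g (k + t) ≡ f t
    unwrapped t _ = cong f (trans (⊖-≤ (m≤m+n k t)) (m+n∸m≡n k t))

CoefficientsOfProduct : (n : ℕ) (a b r : ℕ → ℕ) → Set
CoefficientsOfProduct n a b r =
  ∀ i → i < 2 * n ∸ 1 → r i ≡ sumFromTo (i ∸ (n ∸ 1)) (i ⊓ (n ∸ 1)) (λ k → a (i ∸ k) * b k)

2[1+n]∸1≡n+[1+n] : ∀ n → 2 * suc n ∸ 1 ≡ n + suc n
2[1+n]∸1≡n+[1+n] n = cong (n +_) (+-identityʳ (suc n))

module _ {n a b r} (coefficients : CoefficientsOfProduct n a b r) where

  coefficient-low : ∀ {x} → x < n → r x ≡ sumTo (suc x) (λ t → a (x ∸ t) * b t)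
  coefficient-low {x} x<n@(s≤s {n = n′} x≤n′) =
    trans (coefficients x x<2n∸1)
          (cong₂ (λ lo hi → sumFromTo lo hi (λ k → a (x ∸ k) * b k)) (m≤n⇒m∸n≡0 x≤n′) (m≤n⇒m⊓n≡m x≤n′))
    where
    x<2n∸1 : x < 2 * n ∸ 1
    x<2n∸1 rewrite 2[1+n]∸1≡n+[1+n] n′ = ≤-trans x<n (m≤n+m n n′)

  coefficient-high : r (2 * n ∸ 1) ≡ 0 → ∀ {x} → x < n →
    r (x + n) ≡ sumTo (n ∸ suc x) (λ t → a (x + n ∸ (suc x + t)) * b (suc x + t))
  coefficient-high r-last {x} (s≤s {n = n′} x≤n′) with m≤n⇒m<n∨m≡n x≤n′
  ... | inj₁ x<n′ =
    trans (coefficients (x + n) x+n<2n∸1)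
          (cong₂ (λ lo hi → sumFromTo lo hi (λ k → a (x + n ∸ k) * b k)) lo≡1+x hi≡n′)
    where
    x+n<2n∸1 : x + n < 2 * n ∸ 1
    x+n<2n∸1 rewrite 2[1+n]∸1≡n+[1+n] n′ = +-monoˡ-< n x<n′
    lo≡1+x : x + n ∸ n′ ≡ suc x
    lo≡1+x = trans (cong (_∸ n′) (+-suc x n′)) (m+n∸n≡m (suc x) n′)
    hi≡n′ : (x + n) ⊓ n′ ≡ n′
    hi≡n′ = m≥n⇒m⊓n≡n (≤-trans (n≤1+n n′) (m≤n+m n x))
  ... | inj₂ refl rewrite n∸n≡0 x = trans (cong r (sym (2[1+n]∸1≡n+[1+n] x))) r-last

module Representations (n : ℕ) .{{_ : NonZero n}} (a b : ℕ → ℕ) where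
  open CyclicDifference n

  representations : ℕ → ℕ
  representations x = sumTo n (λ k → a (x ⊖ k) * b k)

  wrapped-coefficient : ∀ {r} → CoefficientsOfProduct n a b r → r (2 * n ∸ 1) ≡ 0 →
    ∀ {x} → x < n → r x + r (x + n) ≡ representations x
  wrapped-coefficient {r} coefficients r-last {x} x<n = sym (begin
    sumTo n g                                                ≡⟨ cong (λ z → sumTo z g) (sym (m+[n∸m]≡n x<n)) ⟩
    sumTo (suc x + (n ∸ suc x)) g                            ≡⟨ sumTo-+ (suc x) (n ∸ suc x) g ⟩
    sumTo (suc x) g + sumTo (n ∸ suc x) (λ t → g (suc x + t))
      ≡⟨ cong₂ _+_ (sumTo-cong (suc x) (λ t t≤x → cong (λ i → a i * b t) (⊖-≤ (≤-pred t≤x))))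
                   (sumTo-cong (n ∸ suc x) (λ t _ → cong (λ i → a i * b (suc x + t)) (⊖-> (s≤s (m≤m+n x t))))) ⟩
    sumTo (suc x) (λ t → a (x ∸ t) * b t)
      + sumTo (n ∸ suc x) (λ t → a (x + n ∸ (suc x + t)) * b (suc x + t))
      ≡⟨ sym (cong₂ _+_ (coefficient-low {a = a} {b} coefficients x<n) (coefficient-high {a = a} {b} coefficients r-last x<n)) ⟩
    r x + r (x + n)                                          ∎)
    where
    open ≡-Reasoning
    g : ℕ → ℕ
    g k = a (x ⊖ k) * b k

  module _ (exactlyOne : ∀ x → x < n → representations x ≡ 1) where

    exactlyOne⇒tiling : Tiling n a b
    exactlyOne⇒tiling x x<n with sumTo≡1⇒∃! n (λ k → a (x ⊖ k) * b k) (exactlyOne x x<n)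
    ... | k , k<n , ab≡1 , unique =
      x ⊖ k , k ,
      (⊖-< x<n k<n , k<n , m*n≡1⇒m≡1 (a (x ⊖ k)) (b k) ab≡1 , m*n≡1⇒n≡1 (a (x ⊖ k)) (b k) ab≡1 , ⊖-+ x<n k<n) ,
      λ i′ k′ i′<n k′<n ai′≡1 bk′≡1 i′+k′≡x →
        let x⊖k′≡i′ = ⊖-unique i′<n k′<n i′+k′≡x
            k′≡k = unique k′ k′<n (λ ab≡0 → 0≢1+n (trans (sym ab≡0)
                     (trans (cong (λ i → a i * b k′) x⊖k′≡i′) (cong₂ _*_ ai′≡1 bk′≡1))))
        in trans (sym x⊖k′≡i′) (cong (x ⊖_) k′≡k) , k′≡k

    exactlyOne⇒|A||B|≡n : sumTo n a * sumTo n b ≡ n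
    exactlyOne⇒|A||B|≡n = begin
      sumTo n a * sumTo n b                                   ≡⟨ sym (sumTo-*ˡ n (sumTo n a) b) ⟩
      sumTo n (λ k → sumTo n a * b k)                         ≡⟨ sumTo-cong n (λ k k<n → cong (_* b k) (sym (sumTo-⊖ a (<⇒≤ k<n)))) ⟩
      sumTo n (λ k → sumTo n (λ x → a (x ⊖ k)) * b k)         ≡⟨ sumTo-cong n (λ k _ → sym (sumTo-*ʳ n (b k) (λ x → a (x ⊖ k)))) ⟩
      sumTo n (λ k → sumTo n (λ x → a (x ⊖ k) * b k))         ≡⟨ sym (sumTo-swap n n (λ x k → a (x ⊖ k) * b k)) ⟩
      sumTo n representations                                 ≡⟨ sumTo-cong n exactlyOne ⟩
      sumTo n (λ _ → 1)                                       ≡⟨ sumTo-const n 1 ⟩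
      n * 1                                                   ≡⟨ *-identityʳ n ⟩
      n                                                       ∎
      where open ≡-Reasoning

[m+n%d]%d≡[m+n]%d : ∀ m n d .{{_ : NonZero d}} → (m + n % d) % d ≡ (m + n) % d
[m+n%d]%d≡[m+n]%d m n d = begin
  (m + n % d) % d          ≡⟨ %-distribˡ-+ m (n % d) d ⟩
  (m % d + n % d % d) % d  ≡⟨ cong (λ z → (m % d + z) % d) (m%n%n≡m%n n d) ⟩
  (m % d + n % d) % d      ≡⟨ sym (%-distribˡ-+ m n d) ⟩
  (m + n) % d              ∎
  where open ≡-Reasoning

block-index-< : ∀ {m p n i c} → m * p ≡ n → i < m → c < p → c * m + i < n
block-index-< {m} {p} {n} {i} {c} mp≡n i<m c<p = begin-strict
  c * m + i  <⟨ +-monoʳ-< (c * m) i<m ⟩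
  c * m + m  ≡⟨ +-comm (c * m) m ⟩
  suc c * m  ≤⟨ *-monoˡ-≤ m c<p ⟩
  p * m      ≡⟨ *-comm p m ⟩
  m * p      ≡⟨ mp≡n ⟩
  n          ∎
  where open ≤-Reasoning

p*u≤p*v≤p∸1+p*u⇒u≡v : ∀ p {u v} → 0 < p → p * u ≤ p * v → p * v ≤ (p ∸ 1) + p * u → u ≡ v
p*u≤p*v≤p∸1+p*u⇒u≡v p@(suc _) {u} {v} _ pu≤pv pv≤p∸1+pu =
  ≤-antisym (*-cancelˡ-≤ p pu≤pv) (m<1+n⇒m≤n (*-cancelˡ-< p v (suc u) pv<p[1+u]))
  where
  pv<p[1+u] : p * v < p * suc u
  pv<p[1+u] = subst (p * v <_) (sym (*-suc p u)) (s≤s pv≤p∸1+pu)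

module Periodicity (n : ℕ) .{{_ : NonZero n}} (b : ℕ → ℕ) where

  Periodic : ℕ → Set
  Periodic t = ∀ x → b ((t + x) % n) ≡ b (x % n)

  periodic-+ : ∀ {s t} → Periodic s → Periodic t → Periodic (s + t)
  periodic-+ {s} {t} per-s per-t x = begin
    b ((s + t + x) % n)    ≡⟨ cong (λ z → b (z % n)) (+-assoc s t x) ⟩
    b ((s + (t + x)) % n)  ≡⟨ per-s (t + x) ⟩
    b ((t + x) % n)        ≡⟨ per-t x ⟩
    b (x % n)              ∎
    where open ≡-Reasoning

  periodic-cancelʳ : ∀ {s t} → Periodic (s + t) → Periodic t → Periodic s
  periodic-cancelʳ {s} {t} per-s+t per-t x = begin
    b ((s + x) % n)        ≡⟨ sym (per-t (s + x)) ⟩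
    b ((t + (s + x)) % n)  ≡⟨ cong (λ z → b (z % n)) (x∙yz≈yx∙z t s x) ⟩
    b ((s + t + x) % n)    ≡⟨ per-s+t x ⟩
    b (x % n)              ∎
    where open ≡-Reasoning

  periodic-* : ∀ c {t} → Periodic t → Periodic (c * t)
  periodic-* zero    per-t x = refl
  periodic-* (suc c) per-t   = periodic-+ per-t (periodic-* c per-t)

  periodic-*n : ∀ c → Periodic (c * n)
  periodic-*n c x = cong b (trans (cong (_% n) (+-comm (c * n) x)) ([m+kn]%n≡m%n x c n))

  periodic-∣ : ∀ {d t} → d ∣ t → Periodic d → Periodic t
  periodic-∣ (divides c t≡c*d) per-d = subst Periodic (sym t≡c*d) (periodic-* c per-d)

  periodic-gcd : ∀ {k} → Periodic k → Periodic (gcd k n)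
  periodic-gcd {k} per-k = fromBézout (Bézout.identity (gcd-GCD k n))
    where
    fromBézout : ∀ {d} → Bézout.Identity d k n → Periodic d
    fromBézout (Bézout.+- x y d+yn≡xk) =
      periodic-cancelʳ (subst Periodic (sym d+yn≡xk) (periodic-* x per-k)) (periodic-*n y)
    fromBézout (Bézout.-+ x y d+xk≡yn) =
      periodic-cancelʳ (subst Periodic (sym d+xk≡yn) (periodic-*n y)) (periodic-* x per-k)

  -- Translation by k is injective on ℤ_n (the preimage of y is y ⊖ k), so k + B = B
  -- transports membership in both directions.
  periodicMod⇒periodic : Binary n b → ∀ {k} → k < n → PeriodicMod n b k → Periodic k
  periodicMod⇒periodic binary {k} k<n k+B≡B x =
    trans (cong b (sym ([m+n%d]%d≡[m+n]%d k x n))) (onResidues (x % n) (m%n<n x n))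
    where
    open CyclicDifference n
    onResidues : ∀ x → x < n → b ((k + x) % n) ≡ b x
    onResidues x x<n with n≤1⇒n≡0∨n≡1 (binary x x<n) | n≤1⇒n≡0∨n≡1 (binary ((k + x) % n) (m%n<n (k + x) n))
    ... | inj₂ bx≡1 | _         = trans (proj₂ (k+B≡B _ (m%n<n (k + x) n)) (x , x<n , bx≡1 , refl)) (sym bx≡1)
    ... | inj₁ bx≡0 | inj₁ by≡0 = trans by≡0 (sym bx≡0)
    ... | inj₁ bx≡0 | inj₂ by≡1 with proj₁ (k+B≡B _ (m%n<n (k + x) n)) by≡1
    ...   | x′ , x′<n , bx′≡1 , k+x′≡y = contradiction (trans (sym bx≡0) (subst (λ z → b z ≡ 1) x′≡x bx′≡1)) 0≢1+n
      where
      x′≡x : x′ ≡ x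
      x′≡x = trans (sym (⊖-unique x′<n k<n (trans (cong (_% n) (+-comm x′ k)) k+x′≡y)))
                   (⊖-unique x<n k<n (cong (_% n) (+-comm x k)))

  module _ {m p} (mp≡n : m * p ≡ n) (per-m : Periodic m) where

    periodic-block : ∀ {i c} → i < m → c < p → b (c * m + i) ≡ b i
    periodic-block {i} {c} i<m c<p = begin
      b (c * m + i)          ≡⟨ cong b (sym (m<n⇒m%n≡m (block-index-< mp≡n i<m c<p))) ⟩
      b ((c * m + i) % n)    ≡⟨ periodic-* c per-m i ⟩
      b (i % n)              ≡⟨ cong b (m<n⇒m%n≡m (block-index-< {c = 0} mp≡n i<m (≤-<-trans z≤n c<p))) ⟩
      b i                    ∎
      where open ≡-Reasoning

    periodic-fibre : ∀ {i} → i < m → sumTo p (λ c → b (i + c * m)) ≡ p * b i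
    periodic-fibre {i} i<m =
      trans (sumTo-cong p (λ c c<p → trans (cong b (+-comm i (c * m))) (periodic-block i<m c<p)))
            (sumTo-const p (b i))

    periodic-sumTo : sumTo n b ≡ p * sumTo m b
    periodic-sumTo = begin
      sumTo n b                                      ≡⟨ cong (λ z → sumTo z b) (trans (sym mp≡n) (*-comm m p)) ⟩
      sumTo (p * m) b                                ≡⟨ sumTo-blocks p m b ⟩
      sumTo p (λ c → sumTo m (λ i → b (c * m + i)))  ≡⟨ sumTo-cong p (λ c c<p → sumTo-cong m (λ i i<m → periodic-block i<m c<p)) ⟩
      sumTo p (λ _ → sumTo m b)                      ≡⟨ sumTo-const p _ ⟩
      p * sumTo m b                                  ∎
      where open ≡-Reasoning

    sumTo-fibreFloor : 0 < p → ∀ {u} →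
      (∀ i → i < m → (sumTo p (λ c → b (i + c * m)) ≤ (p ∸ 1) + p * u i)
                   × (p * u i ≤ sumTo p (λ c → b (i + c * m)))) →
      sumTo m u ≡ sumTo m b
    sumTo-fibreFloor 0<p floors = sumTo-cong m λ i i<m →
      p*u≤p*v≤p∸1+p*u⇒u≡v p 0<p (subst (_ ≤_) (periodic-fibre i<m) (proj₂ (floors i i<m)))
                                (subst (_≤ _) (periodic-fibre i<m) (proj₁ (floors i i<m)))

    periodic⇒¬withinBudget : ∀ {nA} → 0 < nA → 0 < p → nA * sumTo n b ≡ n →
      ¬ (nA * p * (sumTo m b + 1) ≤ n)
    periodic⇒¬withinBudget {nA} 0<nA 0<p |A||B|≡n withinBudget =
      <⇒≱ (*-monoʳ-< (nA * p) {{>-nonZero (*-mono-≤ 0<nA 0<p)}} (m<m+n (sumTo m b) z<s)) (begin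
        nA * p * (sumTo m b + 1)  ≤⟨ withinBudget ⟩
        n                         ≡⟨ sym |A||B|≡n ⟩
        nA * sumTo n b            ≡⟨ cong (nA *_) periodic-sumTo ⟩
        nA * (p * sumTo m b)      ≡⟨ sym (*-assoc nA p (sumTo m b)) ⟩
        nA * p * sumTo m b        ∎)
      where open ≤-Reasoning

prime∣prodFin : ∀ {N q} (f : Fin N → ℕ) → Prime q → q ∣ prodFin f → ∃ λ j → q ∣ f j
prime∣prodFin {zero}  f q-prime q∣1 = contradiction (subst Prime (∣1⇒≡1 q∣1) q-prime) ¬prime[1]
prime∣prodFin {suc N} f q-prime q∣prod with euclidsLemma (f fzero) (prodFin (λ j → f (fsuc j))) q-prime q∣prod
... | inj₁ q∣head = fzero , q∣head
... | inj₂ q∣tail with prime∣prodFin (λ j → f (fsuc j)) q-prime q∣tail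
...   | j , q∣fj = fsuc j , q∣fj

prime∣^⇒∣ : ∀ {q} p α → Prime q → q ∣ p ^ α → q ∣ p
prime∣^⇒∣ p zero    q-prime q∣1 = contradiction (subst Prime (∣1⇒≡1 q∣1) q-prime) ¬prime[1]
prime∣^⇒∣ p (suc α) q-prime q∣p^α+1 = [ id , prime∣^⇒∣ p α q-prime ] (euclidsLemma p (p ^ α) q-prime q∣p^α+1)

∃prime∣ : ∀ c → 2 ≤ c → ∃ λ q → Prime q × q ∣ c
∃prime∣ (suc zero)      (s≤s ())
∃prime∣ c@(suc (suc _)) _ with factorise c
... | record { factors = [] ; isFactorisation = () }
... | record { factors = q ∷ qs ; isFactorisation = c≡q*qs ; factorsPrime = q-prime ∷ _ } =
  q , q-prime , divides (product qs) (trans c≡q*qs (*-comm q (product qs)))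

properDivisor-quotient : ∀ {n c d} → d < n → n ≡ c * d → 2 ≤ c
properDivisor-quotient {c = zero}          ()  refl
properDivisor-quotient {c = suc zero}      d<n n≡1*d =
  contradiction (≤-reflexive (trans n≡1*d (+-identityʳ _))) (<⇒≱ d<n)
properDivisor-quotient {c = suc (suc _)}   _   _     = s≤s (s≤s z≤n)

-- A prime factor of n / d is some p_j, and then d ∣ n / p_j.
properDivisor⇒∣maximal : ∀ {n N d} {p α m : Fin (suc N) → ℕ} → PrimeFactorization n N p α →
  (∀ j → m j * p j ≡ n) → d ∣ n → d < n → ∃ λ j → d ∣ m j
properDivisor⇒∣maximal {n} {d = d} {p} {α} {m} (primes , _ , _ , n≡∏) mp≡n (divides c n≡c*d) d<n
  with ∃prime∣ c (properDivisor-quotient d<n n≡c*d)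
... | q , q-prime , divides c′ c≡c′*q
  with prime∣prodFin (λ j → p j ^ α j) q-prime (subst (q ∣_) n≡∏ q∣n)
  where
  q∣n : q ∣ n
  q∣n = subst (q ∣_) (sym n≡c*d) (∣m⇒∣m*n d (divides c′ c≡c′*q))
... | j , q∣p^α with prime⇒irreducible (primes j) (prime∣^⇒∣ (p j) (α j) q-prime q∣p^α)
...   | inj₁ q≡1  = contradiction (subst Prime q≡1 q-prime) ¬prime[1]
...   | inj₂ refl = j , divides c′ (*-cancelʳ-≡ (m j) (c′ * d) (p j) {{prime⇒nonZero q-prime}} (begin
  m j * p j        ≡⟨ mp≡n j ⟩
  n                ≡⟨ n≡c*d ⟩
  c * d            ≡⟨ cong (_* d) c≡c′*q ⟩
  c′ * p j * d     ≡⟨ xy∙z≈xz∙y c′ (p j) d ⟩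
  c′ * d * p j     ∎))
  where open ≡-Reasoning

aperiodic-if-no-maximal-period : ∀ {n N b} {p α m : Fin (suc N) → ℕ} .{{_ : NonZero n}} →
  PrimeFactorization n N p α → (∀ j → m j * p j ≡ n) → Binary n b → (∀ j → ¬ Periodicity.Periodic n b (m j)) → Aperiodic n b
aperiodic-if-no-maximal-period {n} {b = b} factorization mp≡n binary noPeriod k 0<k k<n k+B≡B
  with properDivisor⇒∣maximal factorization mp≡n (gcd[m,n]∣n k n) (≤-<-trans gcd≤k k<n)
  where
  gcd≤k : gcd k n ≤ k
  gcd≤k = ∣⇒≤ {{>-nonZero 0<k}} (gcd[m,n]∣m k n)
... | j , gcd∣m = noPeriod j (periodic-∣ gcd∣m (periodic-gcd (periodicMod⇒periodic binary k<n k+B≡B)))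
  where open Periodicity n b

mainTheorem1 : (n : ℕ) .{{_ : NonZero n}} → 2 ≤ n →
    (N : ℕ) (p α : Fin (suc N) → ℕ) → PrimeFactorization n N p α →
    (m : Fin (suc N) → ℕ) → (∀ j → m j * p j ≡ n) →
    (a : ℕ → ℕ) → Binary n a → (∃ λ i → i < n × a i ≡ 1) →
    (nA : ℕ) → nA ≡ sumTo n a →
    (b r : ℕ → ℕ) (U : Fin N → ℕ → ℕ) →
    MasterFeasible n N p m a nA b r U →
    Aperiodic n b × Tiling n a b
mainTheorem1 n _ _ p _ factorization m mp≡n a _ (i , i<n , aᵢ≡1) _ refl b _ _
  (binary , _ , _ , r-last , coefficients , wrapped≡1 , budget₁ , fibres , budgets , _) =
  aperiodic-if-no-maximal-period factorization mp≡n binary noPeriod , exactlyOne⇒tiling exactlyOne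
  where
  open Representations n a b
  open Periodicity n b

  exactlyOne : ∀ x → x < n → representations x ≡ 1
  exactlyOne x x<n = trans (sym (wrapped-coefficient coefficients r-last x<n)) (wrapped≡1 x x<n)

  0<p : ∀ j → 0 < p j
  0<p j = >-nonZero⁻¹ (p j) {{prime⇒nonZero (proj₁ factorization j)}}

  withinBudget : ∀ j → Periodic (m j) → sumTo n a * p j * (sumTo (m j) b + 1) ≤ n
  withinBudget fzero _ = begin
    sumTo n a * p fzero * (sumTo (m fzero) b + 1)  ≡⟨ xy∙z≈xz∙y (sumTo n a) (p fzero) _ ⟩
    sumTo n a * (sumTo (m fzero) b + 1) * p fzero  ≤⟨ *-monoˡ-≤ (p fzero) budget₁ ⟩
    m fzero * p fzero                              ≡⟨ mp≡n fzero ⟩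
    n                                              ∎
    where open ≤-Reasoning
  withinBudget (fsuc j) per =
    subst (λ S → sumTo n a * p (fsuc j) * (S + 1) ≤ n)
          (sumTo-fibreFloor (mp≡n (fsuc j)) per (0<p (fsuc j)) (fibres j)) (budgets j)

  noPeriod : ∀ j → ¬ Periodic (m j)
  noPeriod j per = periodic⇒¬withinBudget (mp≡n j) per |A|>0 (0<p j) (exactlyOne⇒|A||B|≡n exactlyOne)
                     (withinBudget j per)
    where
    |A|>0 : 0 < sumTo n a
    |A|>0 = subst (_≤ sumTo n a) aᵢ≡1 (f≤sumTo n a i<n)
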